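{- Let $n\ge 1$ and let $Q$ be the set of all $n$ positions of a single row, or of a single column, of an $n\times n$ matrix (such a $Q$ is a minimum blocker of all $n\times n$ $123$-avoiding permutation matrices). Then there exist $(n-1)^2+1$ linearly independent (as real $n\times n$ matrices) $n\times n$ $123$-avoiding permutation matrices, each of which has exactly one $1$ in a position of $Q$.
   Context: A permutation matrix $P$ contains a $123$-pattern if the $3\times 3$ identity matrix $I_3$ is a submatrix of $P$; otherwise $P$ is $123$-avoiding. A set of positions is a blocker if every $n\times n$ $123$-avoiding permutation matrix has a $1$ in one of its positions, and minimum if removing any element makes it no longer a blocker.
   Formalization: Linear independence of the 123-avoiding permutation matrices is taken over ℚ, the coefficients of a vanishing linear combination being rational rather than real. -}

module Defs where

open import Data.Nat using (ℕ; zero; suc; _+_)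
open import Data.Fin using (Fin; zero; suc; _<_; _≟_)
open import Data.Fin.Permutation using (Permutation′; _⟨$⟩ʳ_)
open import Data.Rational using (ℚ; 0ℚ; 1ℚ) renaming (_+_ to _+ℚ_; _*_ to _*ℚ_)
open import Data.Bool using (Bool; true; false; _∧_; if_then_else_)
open import Data.Product using (Σ; _×_; ∃)
open import Relation.Nullary.Decidable using (⌊_⌋)
open import Relation.Binary.PropositionalEquality using (_≡_)
open import Relation.Nullary using (¬_)

-- n×n real (here: rational) matrices, as functions (row, column) ↦ entry
Mat : ℕ → Set
Mat n = Fin n → Fin n → ℚ

permMatrix : ∀ {n} → Permutation′ n → Mat n
permMatrix σ i j = if ⌊ (σ ⟨$⟩ʳ i) ≟ j ⌋ then 1ℚ else 0ℚ

I₃ : Fin 3 → Fin 3 → ℚ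
I₃ a b = if ⌊ a ≟ b ⌋ then 1ℚ else 0ℚ

StrictlyIncreasing : ∀ {m n} → (Fin m → Fin n) → Set
StrictlyIncreasing f = ∀ a b → a < b → f a < f b

-- P contains a 123-pattern: I₃ is a submatrix of P
-- (rows r₀<r₁<r₂, columns c₀<c₁<c₂ with P(r_a, c_b) = I₃(a,b))
Contains123 : ∀ {n} → Mat n → Set
Contains123 {n} P =
  Σ (Fin 3 → Fin n) λ r → Σ (Fin 3 → Fin n) λ c →
    StrictlyIncreasing r × StrictlyIncreasing c × (∀ a b → P (r a) (c b) ≡ I₃ a b)

Avoids123 : ∀ {n} → Mat n → Set
Avoids123 P = ¬ Contains123 P

∑ℚ : ∀ {m} → (Fin m → ℚ) → ℚ
∑ℚ {zero} f = 0ℚ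
∑ℚ {suc m} f = f zero +ℚ ∑ℚ (λ k → f (suc k))

∑ℕ : ∀ {m} → (Fin m → ℕ) → ℕ
∑ℕ {zero} f = 0
∑ℕ {suc m} f = f zero + ∑ℕ (λ k → f (suc k))

LinearlyIndependent : ∀ {m n} → (Fin m → Mat n) → Set
LinearlyIndependent {m} {n} M =
  (a : Fin m → ℚ) →
  (∀ i j → ∑ℚ (λ k → a k *ℚ M k i j) ≡ 0ℚ) →
  ∀ k → a k ≡ 0ℚ

Positions : ℕ → Set
Positions n = Fin n → Fin n → Bool

isOne : ℚ → Bool
isOne x = ⌊ x Data.Rational.≟ 1ℚ ⌋

onesIn : ∀ {n} → Positions n → Mat n → ℕ
onesIn Q P = ∑ℕ λ i → ∑ℕ λ j → if Q i j ∧ isOne (P i j) then 1 else 0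

IsRow : ∀ {n} → Positions n → Set
IsRow {n} Q = ∃ λ (r : Fin n) → ∀ i j → Q i j ≡ ⌊ i ≟ r ⌋

IsColumn : ∀ {n} → Positions n → Set
IsColumn {n} Q = ∃ λ (c : Fin n) → ∀ i j → Q i j ≡ ⌊ j ≟ c ⌋

-- Write n = m + 1 and let τ(i, j) = insert i j reverse, the anti-identity on the rows and
-- columns other than i and j, with row i sent to column j. Off row i it is decreasing, so it
-- avoids 123, and its 1s lie on the antidiagonals m − 1, m, m + 1, the one on m − 1 strictly
-- north-west of (i, j). Use as pivots (i, j) the corner (0, m) and the m² cells off the
-- antidiagonals m and m + 1, with level 2 for the corner, 1 above and 0 below the antidiagonal.
-- Then τ(v) has a 1 at another pivot u only if v has smaller level than u, so the matrices are
-- triangular with respect to their pivots and hence linearly independent. A permutation matrix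
-- has exactly one 1 in any full row or column.

module Submission where

open import Defs
open import Data.Nat using (ℕ; suc; _≤_; _∸_; _^_; _+_)
open import Data.Fin using (Fin)
open import Data.Fin.Permutation using (Permutation′)
open import Data.Product using (Σ; _×_)
open import Data.Sum using (_⊎_)
open import Relation.Binary.PropositionalEquality using (_≡_)

open import Data.Bool using (Bool; true; false; _∧_; if_then_else_)
open import Data.Bool.Properties using (∧-zeroʳ; ∧-identityʳ)
open import Data.Empty using (⊥)
open import Data.Fin using (zero; suc; toℕ; fromℕ; inject₁; punchIn; punchOut; opposite;
  _↑ˡ_; _↑ʳ_; splitAt; join; remQuot; combine; cast; _≟_)
import Data.Fin as Fin
open import Data.Fin.Patterns using (0F; 1F; 2F)
open import Data.Fin.Permutation using (_⟨$⟩ʳ_; _⟨$⟩ˡ_; inverseˡ; inverseʳ; insert; reverse; insert-punchIn)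
open import Data.Fin.Properties using (suc-injective; toℕ<n; toℕ-fromℕ; toℕ-inject₁; inject₁-injective;
  <-irrefl; punchIn-cancel-≤; punchOut-cancel-≤; punchIn-punchOut; opposite-prop; cast-involutive;
  combine-remQuot; join-splitAt)
open import Data.Nat using (zero; _*_; _<_; s≤s; z<s; s<s; _<?_)
open import Data.Nat.Properties using (+-identityʳ; *-identityʳ; +-suc; +-mono-<; ≤-refl; ≤-reflexive;
  ≤-trans; ≤-irrelevant; <-irrelevant; <-asym; <⇒≢; <⇒≱; ≰⇒>; ≮⇒≥; n≤1+n; m≤n+m; ∸-monoʳ-<; m+[n∸m]≡n)
open import Data.Product using (_,_; proj₁; proj₂; uncurry)
open import Data.Product.Properties using (×-≡,≡→≡)
open import Data.Rational using (ℚ; 0ℚ; 1ℚ) renaming (_+_ to _+ℚ_; _*_ to _*ℚ_)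
import Data.Rational.Properties as ℚ
open import Data.Sum using (inj₁; inj₂; [_,_]′)
open import Function using (_∘_)
open import Relation.Nullary using (Dec; yes; no; contradiction)
open import Relation.Nullary.Decidable using (⌊_⌋)
open import Relation.Binary.PropositionalEquality
  using (_≢_; refl; sym; trans; cong; cong₂; subst; module ≡-Reasoning)

open ≡-Reasoning

∑ℕ-zero : ∀ {m} (f : Fin m → ℕ) → (∀ l → f l ≡ 0) → ∑ℕ f ≡ 0
∑ℕ-zero {zero}  f f≡0 = refl
∑ℕ-zero {suc m} f f≡0 = cong₂ _+_ (f≡0 zero) (∑ℕ-zero (λ l → f (suc l)) (λ l → f≡0 (suc l)))

∑ℕ-single : ∀ {m} (f : Fin m → ℕ) k → (∀ l → l ≢ k → f l ≡ 0) → ∑ℕ f ≡ f k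
∑ℕ-single f zero    f≡0 =
  trans (cong (f zero +_) (∑ℕ-zero _ (λ l → f≡0 (suc l) λ ()))) (+-identityʳ (f zero))
∑ℕ-single f (suc k) f≡0 =
  cong₂ _+_ (f≡0 zero λ ()) (∑ℕ-single _ k (λ l l≢k → f≡0 (suc l) (l≢k ∘ suc-injective)))

∑ℚ-zero : ∀ {m} (f : Fin m → ℚ) → (∀ l → f l ≡ 0ℚ) → ∑ℚ f ≡ 0ℚ
∑ℚ-zero {zero}  f f≡0 = refl
∑ℚ-zero {suc m} f f≡0 = cong₂ _+ℚ_ (f≡0 zero) (∑ℚ-zero (λ l → f (suc l)) (λ l → f≡0 (suc l)))

∑ℚ-single : ∀ {m} (f : Fin m → ℚ) k → (∀ l → l ≢ k → f l ≡ 0ℚ) → ∑ℚ f ≡ f k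
∑ℚ-single f zero f≡0 = begin
  f zero +ℚ ∑ℚ (λ l → f (suc l)) ≡⟨ cong (f zero +ℚ_) (∑ℚ-zero _ (λ l → f≡0 (suc l) λ ())) ⟩
  f zero +ℚ 0ℚ                   ≡⟨ ℚ.+-identityʳ (f zero) ⟩
  f zero                         ∎
∑ℚ-single f (suc k) f≡0 = begin
  f zero +ℚ ∑ℚ (λ l → f (suc l)) ≡⟨ cong (_+ℚ ∑ℚ (λ l → f (suc l))) (f≡0 zero λ ()) ⟩
  0ℚ +ℚ ∑ℚ (λ l → f (suc l))     ≡⟨ ℚ.+-identityˡ _ ⟩
  ∑ℚ (λ l → f (suc l))           ≡⟨ ∑ℚ-single _ k (λ l l≢k → f≡0 (suc l) (l≢k ∘ suc-injective)) ⟩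
  f (suc k)                      ∎

triangular⇒linearlyIndependent :
  ∀ {N n} (M : Fin N → Mat n) (row col : Fin N → Fin n) (level : Fin N → ℕ) →
  (∀ k → M k (row k) (col k) ≡ 1ℚ) →
  (∀ k l → l ≢ k → level k ≤ level l → M l (row k) (col k) ≡ 0ℚ) →
  LinearlyIndependent M
triangular⇒linearlyIndependent M row col level pivot≡1 offPivot≡0 a combination≡0 k =
  vanishes (suc (level k)) k ≤-refl
  where
  vanishes : ∀ bound k → level k < bound → a k ≡ 0ℚ
  vanishes (suc bound) k (s≤s level≤bound) = begin
    a k                                     ≡⟨ sym (ℚ.*-identityʳ (a k)) ⟩
    a k *ℚ 1ℚ                               ≡⟨ cong (a k *ℚ_) (sym (pivot≡1 k)) ⟩
    a k *ℚ M k (row k) (col k)              ≡⟨ sym (∑ℚ-single _ k others) ⟩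
    ∑ℚ (λ l → a l *ℚ M l (row k) (col k))  ≡⟨ combination≡0 (row k) (col k) ⟩
    0ℚ                                      ∎
    where
    others : ∀ l → l ≢ k → a l *ℚ M l (row k) (col k) ≡ 0ℚ
    others l l≢k with level l <? bound
    ... | yes lower =
      trans (cong (_*ℚ M l (row k) (col k)) (vanishes bound l lower)) (ℚ.*-zeroˡ (M l (row k) (col k)))
    ... | no ¬lower =
      trans (cong (a l *ℚ_) (offPivot≡0 k l l≢k (≤-trans level≤bound (≮⇒≥ ¬lower)))) (ℚ.*-zeroʳ (a l))

module _ {n} (σ : Permutation′ n) where

  permMatrix-≡1 : ∀ {i j} → σ ⟨$⟩ʳ i ≡ j → permMatrix σ i j ≡ 1ℚ
  permMatrix-≡1 {i} {j} σi≡j with σ ⟨$⟩ʳ i ≟ j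
  ... | yes _ = refl
  ... | no σi≢j = contradiction σi≡j σi≢j

  permMatrix-≡0 : ∀ {i j} → σ ⟨$⟩ʳ i ≢ j → permMatrix σ i j ≡ 0ℚ
  permMatrix-≡0 {i} {j} σi≢j with σ ⟨$⟩ʳ i ≟ j
  ... | yes σi≡j = contradiction σi≡j σi≢j
  ... | no _ = refl

  permMatrix-≡1⇒ : ∀ {i j} → permMatrix σ i j ≡ 1ℚ → σ ⟨$⟩ʳ i ≡ j
  permMatrix-≡1⇒ {i} {j} _ with σ ⟨$⟩ʳ i ≟ j
  permMatrix-≡1⇒ _  | yes σi≡j = σi≡j
  permMatrix-≡1⇒ () | no _

  onesIn-permMatrix : ∀ (Q : Positions n) x → Q x (σ ⟨$⟩ʳ x) ≡ true →
    (∀ i → Q i (σ ⟨$⟩ʳ i) ≡ true → i ≡ x) → onesIn Q (permMatrix σ) ≡ 1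
  onesIn-permMatrix Q x Qx unique =
    trans (∑ℕ-single onesInRow x otherRows) (trans (onesInRow≡ x) (cong indicator Qx))
    where
    indicator : Bool → ℕ
    indicator b = if b then 1 else 0
    onesInRow : Fin n → ℕ
    onesInRow i = ∑ℕ λ j → indicator (Q i j ∧ isOne (permMatrix σ i j))
    onesInRow≡ : ∀ i → onesInRow i ≡ indicator (Q i (σ ⟨$⟩ʳ i))
    onesInRow≡ i = trans (∑ℕ-single _ (σ ⟨$⟩ʳ i) offOne) onOne
      where
      offOne : ∀ j → j ≢ σ ⟨$⟩ʳ i → indicator (Q i j ∧ isOne (permMatrix σ i j)) ≡ 0
      offOne j j≢σi rewrite permMatrix-≡0 (j≢σi ∘ sym) | ∧-zeroʳ (Q i j) = refl
      onOne : indicator (Q i (σ ⟨$⟩ʳ i) ∧ isOne (permMatrix σ i (σ ⟨$⟩ʳ i))) ≡ indicator (Q i (σ ⟨$⟩ʳ i))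
      onOne rewrite permMatrix-≡1 {i} refl | ∧-identityʳ (Q i (σ ⟨$⟩ʳ i)) = refl
    otherRows : ∀ i → i ≢ x → onesInRow i ≡ 0
    otherRows i i≢x with Q i (σ ⟨$⟩ʳ i) in Qi | onesInRow≡ i
    ... | true  | _ = contradiction (unique i Qi) i≢x
    ... | false | count = count

⌊≟⌋-true : ∀ {n} {i j : Fin n} → i ≡ j → ⌊ i ≟ j ⌋ ≡ true
⌊≟⌋-true {i = i} {j} i≡j with i ≟ j
... | yes _ = refl
... | no i≢j = contradiction i≡j i≢j

⌊≟⌋-true⇒≡ : ∀ {n} {i j : Fin n} → ⌊ i ≟ j ⌋ ≡ true → i ≡ j
⌊≟⌋-true⇒≡ {i = i} {j} _ with i ≟ j
⌊≟⌋-true⇒≡ _ | yes i≡j = i≡j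
⌊≟⌋-true⇒≡ () | no _

onesIn-line : ∀ {n} (Q : Positions n) (σ : Permutation′ n) → IsRow Q ⊎ IsColumn Q →
  onesIn Q (permMatrix σ) ≡ 1
onesIn-line Q σ (inj₁ (r , Q≡)) =
  onesIn-permMatrix σ Q r (trans (Q≡ r _) (⌊≟⌋-true refl)) λ i Qi → ⌊≟⌋-true⇒≡ (trans (sym (Q≡ i _)) Qi)
onesIn-line Q σ (inj₂ (c , Q≡)) =
  onesIn-permMatrix σ Q (σ ⟨$⟩ˡ c) (trans (Q≡ _ _) (⌊≟⌋-true (inverseʳ σ)))
    λ i Qi → trans (sym (inverseˡ σ)) (cong (σ ⟨$⟩ˡ_) (⌊≟⌋-true⇒≡ (trans (sym (Q≡ i _)) Qi)))

DecreasingOffRow : ∀ {n} → Fin n → Permutation′ n → Set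
DecreasingOffRow i σ = ∀ {r r′} → i ≢ r → i ≢ r′ → r Fin.< r′ → σ ⟨$⟩ʳ r′ Fin.< σ ⟨$⟩ʳ r

I₃-diagonal : ∀ a → I₃ a a ≡ 1ℚ
I₃-diagonal 0F = refl
I₃-diagonal 1F = refl
I₃-diagonal 2F = refl

decreasingOffRow⇒avoids123 : ∀ {n} {i : Fin n} (σ : Permutation′ n) → DecreasingOffRow i σ →
  Avoids123 (permMatrix σ)
decreasingOffRow⇒avoids123 {i = i} σ decreasing (r , c , r↑ , c↑ , P≡I₃) = pickTwoRows (i ≟ r 0F) (i ≟ r 1F)
  where
  onDiagonal : ∀ a → σ ⟨$⟩ʳ r a ≡ c a
  onDiagonal a = permMatrix-≡1⇒ σ (trans (P≡I₃ a a) (I₃-diagonal a))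
  increasingPair : ∀ a b → a Fin.< b → i ≢ r a → i ≢ r b → ⊥
  increasingPair a b a<b i≢rₐ i≢r_b = <-asym (decreasing i≢rₐ i≢r_b (r↑ a b a<b)) σrₐ<σr_b
    where
    σrₐ<σr_b : σ ⟨$⟩ʳ r a Fin.< σ ⟨$⟩ʳ r b
    σrₐ<σr_b rewrite onDiagonal a | onDiagonal b = c↑ a b a<b
  pickTwoRows : Dec (i ≡ r 0F) → Dec (i ≡ r 1F) → ⊥
  pickTwoRows (yes i≡r₀) (yes i≡r₁) = <-irrefl (trans (sym i≡r₀) i≡r₁) (r↑ 0F 1F z<s)
  pickTwoRows (yes i≡r₀) (no  i≢r₁) =
    increasingPair 1F 2F (s<s z<s) i≢r₁ λ i≡r₂ → <-irrefl (trans (sym i≡r₀) i≡r₂) (r↑ 0F 2F z<s)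
  pickTwoRows (no  i≢r₀) (yes i≡r₁) =
    increasingPair 0F 2F z<s i≢r₀ λ i≡r₂ → <-irrefl (trans (sym i≡r₁) i≡r₂) (r↑ 1F 2F (s<s z<s))
  pickTwoRows (no  i≢r₀) (no  i≢r₁) = increasingPair 0F 1F z<s i≢r₀ i≢r₁

toℕ-punchIn : ∀ {m} (i : Fin (suc m)) (k : Fin m) →
  (toℕ k < toℕ i × toℕ (punchIn i k) ≡ toℕ k) ⊎ toℕ (punchIn i k) ≡ suc (toℕ k)
toℕ-punchIn zero    k       = inj₂ refl
toℕ-punchIn (suc i) zero    = inj₁ (z<s , refl)
toℕ-punchIn (suc i) (suc k) with toℕ-punchIn i k
... | inj₁ (k<i , i↑k≡k) = inj₁ (s<s k<i , cong suc i↑k≡k)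
... | inj₂ i↑k≡1+k       = inj₂ (cong suc i↑k≡1+k)

punchIn-mono-< : ∀ {m} (i : Fin (suc m)) {k k′ : Fin m} → k Fin.< k′ → punchIn i k Fin.< punchIn i k′
punchIn-mono-< i {k} {k′} k<k′ = ≰⇒> (<⇒≱ k<k′ ∘ punchIn-cancel-≤ i k′ k)

punchOut-mono-< : ∀ {m} {i r r′ : Fin (suc m)} (i≢r : i ≢ r) (i≢r′ : i ≢ r′) →
  r Fin.< r′ → punchOut i≢r Fin.< punchOut i≢r′
punchOut-mono-< i≢r i≢r′ r<r′ = ≰⇒> (<⇒≱ r<r′ ∘ punchOut-cancel-≤ i≢r′ i≢r)

opposite-antimono-< : ∀ {m} {k k′ : Fin m} → k Fin.< k′ → opposite k′ Fin.< opposite k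
opposite-antimono-< {m} {k} {k′} k<k′ rewrite opposite-prop k | opposite-prop k′ =
  ∸-monoʳ-< (s<s k<k′) (toℕ<n k′)

suc[toℕ+toℕ-opposite]≡m : ∀ {m} (k : Fin m) → suc (toℕ k + toℕ (opposite k)) ≡ m
suc[toℕ+toℕ-opposite]≡m k rewrite opposite-prop k = m+[n∸m]≡n (toℕ<n k)

antidiagonal : ∀ {n} → Fin n × Fin n → ℕ
antidiagonal (r , c) = toℕ r + toℕ c

NearAntidiagonal : ∀ {m} → (center cell : Fin (suc m) × Fin (suc m)) → Set
NearAntidiagonal {m} (i , j) (r , c) =
  (suc (antidiagonal (r , c)) ≡ m × toℕ r < toℕ i × toℕ c < toℕ j) ⊎
  antidiagonal (r , c) ≡ m ⊎ antidiagonal (r , c) ≡ suc m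

reverseThrough : ∀ {m} → Fin (suc m) → Fin (suc m) → Permutation′ (suc m)
reverseThrough i j = insert i j reverse

module _ {m} (i j : Fin (suc m)) where

  reverseThrough-row : reverseThrough i j ⟨$⟩ʳ i ≡ j
  reverseThrough-row with i ≟ i
  ... | yes _ = refl
  ... | no i≢i = contradiction refl i≢i

  reverseThrough-punchIn : ∀ k → reverseThrough i j ⟨$⟩ʳ punchIn i k ≡ punchIn j (opposite k)
  reverseThrough-punchIn = insert-punchIn i j reverse

  reverseThrough-offRow : ∀ {r} (i≢r : i ≢ r) → reverseThrough i j ⟨$⟩ʳ r ≡ punchIn j (opposite (punchOut i≢r))
  reverseThrough-offRow i≢r =
    trans (cong (reverseThrough i j ⟨$⟩ʳ_) (sym (punchIn-punchOut i≢r))) (reverseThrough-punchIn _)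

  reverseThrough-decreasing : DecreasingOffRow i (reverseThrough i j)
  reverseThrough-decreasing i≢r i≢r′ r<r′
    rewrite reverseThrough-offRow i≢r | reverseThrough-offRow i≢r′ =
    punchIn-mono-< j (opposite-antimono-< (punchOut-mono-< i≢r i≢r′ r<r′))

  reverseThrough-nearAntidiagonal : ∀ {r c} → i ≢ r → reverseThrough i j ⟨$⟩ʳ r ≡ c →
    NearAntidiagonal (i , j) (r , c)
  reverseThrough-nearAntidiagonal i≢r refl =
    subst (λ r → NearAntidiagonal (i , j) (r , reverseThrough i j ⟨$⟩ʳ r))
      (punchIn-punchOut i≢r) (punchIn-nearAntidiagonal (punchOut i≢r))
    where
    punchIn-nearAntidiagonal : ∀ k →
      NearAntidiagonal (i , j) (punchIn i k , reverseThrough i j ⟨$⟩ʳ punchIn i k)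
    -- Row punchIn i k holds column punchIn j (opposite k); each punchIn adds 0 or 1 to k + opposite k = m − 1.
    punchIn-nearAntidiagonal k rewrite reverseThrough-punchIn k
      with toℕ-punchIn i k | toℕ-punchIn j (opposite k) | suc[toℕ+toℕ-opposite]≡m k
    ... | inj₁ (k<i , r≡k) | inj₁ (o<j , c≡o) | 1+k+o≡m rewrite r≡k | c≡o = inj₁ (1+k+o≡m , k<i , o<j)
    ... | inj₁ (_ , r≡k)   | inj₂ c≡1+o       | 1+k+o≡m rewrite r≡k | c≡1+o | +-suc (toℕ k) (toℕ (opposite k)) =
      inj₂ (inj₁ 1+k+o≡m)
    ... | inj₂ r≡1+k       | inj₁ (_ , c≡o)   | 1+k+o≡m rewrite r≡1+k | c≡o = inj₂ (inj₁ 1+k+o≡m)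
    ... | inj₂ r≡1+k       | inj₂ c≡1+o       | 1+k+o≡m rewrite r≡1+k | c≡1+o | +-suc (toℕ k) (toℕ (opposite k)) =
      inj₂ (inj₂ (cong suc 1+k+o≡m))

data Pivot (m : ℕ) : Set where
  corner : Pivot m
  above  : (a b : Fin m) → toℕ a + toℕ b < m → Pivot m
  below  : (a b : Fin m) → m ≤ toℕ a + toℕ b → Pivot m

position : ∀ {m} → Pivot m → Fin (suc m) × Fin (suc m)
position {m} corner = zero , fromℕ m
position (above a b _) = inject₁ a , inject₁ b
position (below a b _) = suc a , suc b

level : ∀ {m} → Pivot m → ℕ
level corner        = 2
level (above _ _ _) = 1
level (below _ _ _) = 0

pivotPermutation : ∀ {m} → Pivot m → Permutation′ (suc m)
pivotPermutation u = reverseThrough (proj₁ (position u)) (proj₂ (position u))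

antidiagonal-corner : ∀ {m} → antidiagonal (position (corner {m})) ≡ m
antidiagonal-corner {m} = toℕ-fromℕ m

antidiagonal-above : ∀ {m} a b (a+b<m : toℕ a + toℕ b < m) →
  antidiagonal (position (above a b a+b<m)) < m
antidiagonal-above a b a+b<m rewrite toℕ-inject₁ a | toℕ-inject₁ b = a+b<m

antidiagonal-below : ∀ {m} a b (m≤a+b : m ≤ toℕ a + toℕ b) →
  suc (suc m) ≤ antidiagonal (position (below a b m≤a+b))
antidiagonal-below a b m≤a+b rewrite +-suc (toℕ a) (toℕ b) = s≤s (s≤s m≤a+b)

antidiagonal-above≢corner : ∀ {m} a b (a+b<m : toℕ a + toℕ b < m) →
  antidiagonal (position (above a b a+b<m)) ≢ antidiagonal (position (corner {m}))
antidiagonal-above≢corner a b a+b<m eq = <⇒≢ (antidiagonal-above a b a+b<m) (trans eq antidiagonal-corner)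

antidiagonal-above≢below : ∀ {m} a b a′ b′ (a+b<m : toℕ a + toℕ b < m) (m≤a′+b′ : m ≤ toℕ a′ + toℕ b′) →
  antidiagonal (position (above a b a+b<m)) ≢ antidiagonal (position (below a′ b′ m≤a′+b′))
antidiagonal-above≢below {m} a b a′ b′ a+b<m m≤a′+b′ eq =
  <⇒≱ (antidiagonal-above a b a+b<m)
    (≤-trans (m≤n+m m 2) (subst (suc (suc m) ≤_) (sym eq) (antidiagonal-below a′ b′ m≤a′+b′)))

position-injective : ∀ {m} {u v : Pivot m} → position u ≡ position v → u ≡ v
position-injective {u = corner} {corner} _ = refl
position-injective {u = corner} {above a b a+b<m} eq =
  contradiction (cong antidiagonal eq) (antidiagonal-above≢corner a b a+b<m ∘ sym)
position-injective {u = corner} {below a b m≤a+b} eq = contradiction (cong proj₁ eq) λ ()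
position-injective {u = above a b a+b<m} {corner} eq =
  contradiction (cong antidiagonal eq) (antidiagonal-above≢corner a b a+b<m)
position-injective {u = above a b a+b<m} {above a′ b′ a′+b′<m} eq
  with inject₁-injective (cong proj₁ eq) | inject₁-injective (cong proj₂ eq)
... | refl | refl = cong (above a b) (<-irrelevant a+b<m a′+b′<m)
position-injective {u = above a b a+b<m} {below a′ b′ m≤a′+b′} eq =
  contradiction (cong antidiagonal eq) (antidiagonal-above≢below a b a′ b′ a+b<m m≤a′+b′)
position-injective {u = below a b m≤a+b} {corner} eq = contradiction (cong proj₁ eq) λ ()
position-injective {u = below a b m≤a+b} {above a′ b′ a′+b′<m} eq =
  contradiction (cong antidiagonal eq) (antidiagonal-above≢below a′ b′ a b a′+b′<m m≤a+b ∘ sym)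
position-injective {u = below a b m≤a+b} {below a′ b′ m≤a′+b′} eq
  with suc-injective (cong proj₁ eq) | suc-injective (cong proj₂ eq)
... | refl | refl = cong (below a b) (≤-irrelevant m≤a+b m≤a′+b′)

nearAntidiagonal-≤ : ∀ {m} {center cell : Fin (suc m) × Fin (suc m)} → NearAntidiagonal center cell →
  antidiagonal cell ≤ suc m
nearAntidiagonal-≤ {m} (inj₁ (s+1≡m , _)) = ≤-trans (n≤1+n _) (≤-trans (≤-reflexive s+1≡m) (n≤1+n m))
nearAntidiagonal-≤ {m} (inj₂ (inj₁ s≡m))  = ≤-trans (≤-reflexive s≡m) (n≤1+n m)
nearAntidiagonal-≤     (inj₂ (inj₂ s≡1+m)) = ≤-reflexive s≡1+m

nearAntidiagonal⇒level< : ∀ {m} (u v : Pivot m) → u ≢ v → NearAntidiagonal (position v) (position u) →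
  level v < level u
nearAntidiagonal⇒level< corner corner u≢v _ = contradiction refl u≢v
nearAntidiagonal⇒level< corner (above _ _ _) _ _ = s<s z<s
nearAntidiagonal⇒level< corner (below _ _ _) _ _ = z<s
nearAntidiagonal⇒level< {m} (above a b a+b<m) _ _ (inj₂ onAntidiagonal) =
  contradiction ([ ≤-reflexive ∘ sym , ≤-trans (n≤1+n m) ∘ ≤-reflexive ∘ sym ]′ onAntidiagonal)
    (<⇒≱ (antidiagonal-above a b a+b<m))
nearAntidiagonal⇒level< (above _ _ _) corner _ (inj₁ (_ , () , _))
nearAntidiagonal⇒level< (above a b a+b<m) v@(above a′ b′ a′+b′<m) _ (inj₁ (s+1≡m , r<i , c<j)) =
  contradiction (subst (_≤ antidiagonal (position v)) s+1≡m (+-mono-< r<i c<j))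
    (<⇒≱ (antidiagonal-above a′ b′ a′+b′<m))
nearAntidiagonal⇒level< (above _ _ _) (below _ _ _) _ _ = z<s
nearAntidiagonal⇒level< (below a b m≤a+b) _ _ near =
  contradiction (nearAntidiagonal-≤ near) (<⇒≱ (antidiagonal-below a b m≤a+b))

pivotPermutation-pivot : ∀ {m} (u : Pivot m) → pivotPermutation u ⟨$⟩ʳ proj₁ (position u) ≡ proj₂ (position u)
pivotPermutation-pivot u = reverseThrough-row (proj₁ (position u)) (proj₂ (position u))

hit⇒level< : ∀ {m} {u v : Pivot m} → u ≢ v →
  pivotPermutation v ⟨$⟩ʳ proj₁ (position u) ≡ proj₂ (position u) → level v < level u
hit⇒level< {u = u} {v} u≢v hit =
  nearAntidiagonal⇒level< u v u≢v (reverseThrough-nearAntidiagonal _ _ differentRows hit)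
  where
  differentRows : proj₁ (position v) ≢ proj₁ (position u)
  differentRows sameRow = u≢v (position-injective (×-≡,≡→≡ (sym sameRow , (begin
    proj₂ (position u)                          ≡⟨ sym hit ⟩
    pivotPermutation v ⟨$⟩ʳ proj₁ (position u)  ≡⟨ cong (pivotPermutation v ⟨$⟩ʳ_) (sym sameRow) ⟩
    pivotPermutation v ⟨$⟩ʳ proj₁ (position v)  ≡⟨ pivotPermutation-pivot v ⟩
    proj₂ (position v)                          ∎))))

module _ {m : ℕ} where

  pairOf : Fin (m ^ 2) → Fin m × Fin m
  pairOf x = proj₁ (remQuot {m} (m * 1) x) , cast (*-identityʳ m) (proj₂ (remQuot {m} (m * 1) x))

  unpair : Fin m × Fin m → Fin (m ^ 2)
  unpair (a , b) = combine a (cast (sym (*-identityʳ m)) b)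

  unpair-pairOf : ∀ x → unpair (pairOf x) ≡ x
  unpair-pairOf x = begin
    unpair (pairOf x)  ≡⟨ cong (combine a) (cast-involutive (sym (*-identityʳ m)) (*-identityʳ m) y) ⟩
    combine a y        ≡⟨ combine-remQuot {m} (m * 1) x ⟩
    x                  ∎
    where
    a = proj₁ (remQuot {m} (m * 1) x)
    y = proj₂ (remQuot {m} (m * 1) x)

  classify : Fin m → Fin m → Pivot m
  classify a b with toℕ a + toℕ b <? m
  ... | yes a+b<m = above a b a+b<m
  ... | no  a+b≮m = below a b (≮⇒≥ a+b≮m)

  pivotOf : Fin (m ^ 2 + 1) → Pivot m
  pivotOf k = [ uncurry classify ∘ pairOf , (λ _ → corner) ]′ (splitAt (m ^ 2) k)

  indexOf : Pivot m → Fin (m ^ 2 + 1)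
  indexOf corner        = m ^ 2 ↑ʳ zero
  indexOf (above a b _) = unpair (a , b) ↑ˡ 1
  indexOf (below a b _) = unpair (a , b) ↑ˡ 1

  indexOf-classify : ∀ a b → indexOf (classify a b) ≡ unpair (a , b) ↑ˡ 1
  indexOf-classify a b with toℕ a + toℕ b <? m
  ... | yes _ = refl
  ... | no  _ = refl

  indexOf-pivotOf : ∀ k → indexOf (pivotOf k) ≡ k
  indexOf-pivotOf k = trans (indexOf-decode (splitAt (m ^ 2) k)) (join-splitAt (m ^ 2) 1 k)
    where
    indexOf-decode : ∀ s → indexOf ([ uncurry classify ∘ pairOf , (λ _ → corner) ]′ s) ≡ join (m ^ 2) 1 s
    indexOf-decode (inj₁ x)    = trans (indexOf-classify _ _) (cong (_↑ˡ 1) (unpair-pairOf x))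
    indexOf-decode (inj₂ zero) = refl

  pivotOf-injective : ∀ {k l} → pivotOf k ≡ pivotOf l → k ≡ l
  pivotOf-injective {k} {l} eq = trans (sym (indexOf-pivotOf k)) (trans (cong indexOf eq) (indexOf-pivotOf l))

lemma4p5 : (n : ℕ) → 1 ≤ n → (Q : Positions n) → IsRow Q ⊎ IsColumn Q →
    Σ (Fin ((n ∸ 1) ^ 2 + 1) → Permutation′ n) λ σ →
      LinearlyIndependent (λ k → permMatrix (σ k)) ×
      (∀ k → Avoids123 (permMatrix (σ k))) ×
      (∀ k → onesIn Q (permMatrix (σ k)) ≡ 1)
lemma4p5 (suc m) _ Q line = σ , independent , avoids , (λ k → onesIn-line Q (σ k) line)
  where
  pivot : Fin (m ^ 2 + 1) → Pivot m
  pivot = pivotOf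
  σ : Fin (m ^ 2 + 1) → Permutation′ (suc m)
  σ = pivotPermutation ∘ pivot
  row col : Fin (m ^ 2 + 1) → Fin (suc m)
  row = proj₁ ∘ position ∘ pivot
  col = proj₂ ∘ position ∘ pivot
  independent : LinearlyIndependent (λ k → permMatrix (σ k))
  independent = triangular⇒linearlyIndependent (permMatrix ∘ σ) row col (level ∘ pivot)
    (λ k → permMatrix-≡1 (σ k) (pivotPermutation-pivot (pivot k)))
    (λ k l l≢k k≼l → permMatrix-≡0 (σ l) λ hit → <⇒≱ (hit⇒level< (l≢k ∘ sym ∘ pivotOf-injective) hit) k≼l)
  avoids : ∀ k → Avoids123 (permMatrix (σ k))
  avoids k = decreasingOffRow⇒avoids123 (σ k) (reverseThrough-decreasing (row k) (col k))
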